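{- Let $\mathcal{L}$ be the category whose objects are natural numbers and whose morphisms $m\to n$ are the total injective increasing functions $[m]\to[n]$, let $\mathcal{G}$ be its full subcategory on the objects $1$ and $2$, and $I:\mathcal{G}\to\mathcal{L}$ the inclusion. A finite graph $G\in\hat{\mathcal{G}}$ is such that the diagram $I\circ\pi_G:\mathrm{El}(G)\to\mathcal{L}$ admits a colimit in $\mathcal{L}$ if and only if $G$ is (1) acyclic: for every vertex $x$, the only path from $x$ to $x$ is the empty path; and (2) connected in the following sense: for every pair of vertices $x,y$ there exists a path from $x$ to $y$ or a path from $y$ to $x$.
   Context: For $n\in\mathbb{N}$ write $[n]=\{0,\dots,n-1\}$; $s^n_i:n\to n+1$ is the increasing injection with image $[n+1]\setminus\{i\}$. The only non-identity morphisms of $\mathcal{G}$ are $s^1_0,s^1_1:1\to2$, so $G\in\hat{\mathcal{G}}$ is a graph with vertices $G(1)$, edges $G(2)$, source $G(s^1_1)$ and target $G(s^1_0)$; finite means $G(1),G(2)$ finite. Paths are finite (possibly empty) sequences of composable edges. $\mathrm{El}(G)$ has objects $(k,x)$ with $k\in\{1,2\}$, $x\in G(k)$, and morphisms $(k,x)\to(k',x')$ the morphisms $u:k\to k'$ of $\mathcal{G}$ with $G(u)(x')=x$; $\pi_G$ is the first projection. -}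

module Defs where

open import Data.Nat using (ℕ)
open import Data.Fin using (Fin; zero; suc; _<_)
open import Data.Fin.Properties using ()
open import Data.Product using (Σ; _×_; _,_; proj₁; proj₂)
open import Data.Sum using (_⊎_)
open import Relation.Binary.PropositionalEquality using (_≡_; refl)
import Data.Nat as ℕ

-- The category 𝓛: objects ℕ, morphisms m → n are the (total) injective
-- increasing maps [m] → [n], i.e. strictly increasing maps Fin m → Fin n.
-- Morphisms are compared pointwise.

record LHom (m n : ℕ) : Set where
  constructor mkL
  field
    fun  : Fin m → Fin n
    incr : ∀ {i j : Fin m} → i < j → fun i < fun j
open LHom public

_≈L_ : ∀ {m n} → LHom m n → LHom m n → Set
f ≈L g = ∀ i → fun f i ≡ fun g i

idL : ∀ {n} → LHom n n
idL = mkL (λ i → i) (λ i<j → i<j)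

_∘L_ : ∀ {m n p} → LHom n p → LHom m n → LHom m p
f ∘L g = mkL (λ i → fun f (fun g i)) (λ i<j → incr f (incr g i<j))

data GObj : Set where
  g1 g2 : GObj

I₀ : GObj → ℕ
I₀ g1 = 1
I₀ g2 = 2

data GHom : GObj → GObj → Set where
  gid : ∀ {a} → GHom a a
  s¹₀ : GHom g1 g2   -- image [2] ∖ {0} : 0 ↦ 1
  s¹₁ : GHom g1 g2   -- image [2] ∖ {1} : 0 ↦ 0

s10L : LHom 1 2
s10L = mkL (λ _ → suc zero) (λ { {zero} {zero} () })

s11L : LHom 1 2
s11L = mkL (λ _ → zero) (λ { {zero} {zero} () })

I₁ : ∀ {a b} → GHom a b → LHom (I₀ a) (I₀ b)
I₁ gid = idL
I₁ s¹₀ = s10L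
I₁ s¹₁ = s11L

-- Finite graphs = finite presheaves on 𝓖:
-- G(1) = vertices, G(2) = edges, G(s¹₁) = source, G(s¹₀) = target.

record FinGraph : Set where
  field
    nV  : ℕ
    nE  : ℕ
    src : Fin nE → Fin nV
    tgt : Fin nE → Fin nV
open FinGraph public

Ob : (G : FinGraph) → GObj → Set
Ob G g1 = Fin (nV G)
Ob G g2 = Fin (nE G)

act : (G : FinGraph) → ∀ {a b} → GHom a b → Ob G b → Ob G a
act G gid x = x
act G s¹₀ e = tgt G e
act G s¹₁ e = src G e

ElObj : FinGraph → Set
ElObj G = Σ GObj (Ob G)

ElHom : (G : FinGraph) → ElObj G → ElObj G → Set
ElHom G (a , x) (b , y) = Σ (GHom a b) (λ u → act G u y ≡ x)

record Cocone (G : FinGraph) (n : ℕ) : Set where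
  field
    leg : (o : ElObj G) → LHom (I₀ (proj₁ o)) n
    nat : ∀ {o o' : ElObj G} (m : ElHom G o o') →
          (leg o' ∘L I₁ (proj₁ m)) ≈L leg o
open Cocone public

IsColimit : (G : FinGraph) (n : ℕ) → Cocone G n → Set
IsColimit G n c =
  ∀ (n' : ℕ) (c' : Cocone G n') →
    Σ (LHom n n') (λ u →
      (∀ o → (u ∘L leg c o) ≈L leg c' o) ×
      (∀ (u' : LHom n n') → (∀ o → (u' ∘L leg c o) ≈L leg c' o) → u' ≈L u))

HasColimit : FinGraph → Set
HasColimit G = Σ ℕ (λ n → Σ (Cocone G n) (λ c → IsColimit G n c))

data Path (G : FinGraph) : Fin (nV G) → Fin (nV G) → Set where
  []  : ∀ {x} → Path G x x
  step : ∀ {x y} (e : Fin (nE G)) → src G e ≡ x → Path G (tgt G e) y → Path G x y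

Acyclic : FinGraph → Set
Acyclic G = ∀ (x : Fin (nV G)) (p : Path G x x) → p ≡ []

Connected : FinGraph → Set
Connected G = ∀ (x y : Fin (nV G)) → Path G x y ⊎ Path G y x

module Submission where

-- A cocone over I ∘ π_G with apex n is the same thing as a *labelling* of the
-- vertices of G by elements of [n] that strictly increases along every edge:
-- the leg at a vertex picks its label, and naturality forces the leg at an edge
-- e to be the pair (label (src e), label (tgt e)).  Consequently:
--  * a graph carrying a labelling is acyclic, and reachability in it is
--    decidable, since a path only climbs through the finitely many labels;
--  * (⇒) if the cocone is universal, every vertex y unreachable from x has a
--    smaller label than x: lifting the vertices reachable from x by n gives a
--    labelling in [n + n], and the strictly increasing factorization through
--    the universal cocone puts x above y.  Two mutually unreachable vertices
--    would then lie below each other, so G is connected;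
--  * (⇐) if G is acyclic and connected, "there is a nonempty path from x to y"
--    is a decidable strict total order on the vertices.  Ranking a vertex by
--    the number of its predecessors is a bijection onto [nV G] increasing
--    along edges, and the resulting cocone is universal because every other
--    labelling is increasing for this order.

open import Defs
open import Data.Bool using (true)
open import Data.Nat using (ℕ; zero; suc; _+_; z≤n; s≤s) renaming (_≤_ to _≤ℕ_; _<_ to _<ℕ_)
import Data.Nat.Properties as ℕ
open import Data.Fin using (Fin; zero; suc; toℕ; fromℕ<; _↑ˡ_; _↑ʳ_; _≟_; _<_; _≤_; punchOut)
import Data.Fin.Properties as Fin
open import Data.Fin.Subset using (Subset; ⊤; _∈_; ∣_∣)
open import Data.Fin.Subset.Properties using (∈⊤; ∣⊤∣≡n; p⊂q⇒∣p∣<∣q∣)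
open import Data.Vec using (tabulate)
open import Data.Vec.Properties using (lookup∘tabulate; []=⇒lookup; lookup⇒[]=)
open import Data.Product using (∃; _×_; _,_; proj₁; proj₂)
open import Data.Sum using (inj₁; inj₂; _⊎_)
open import Function using (_∘_)
open import Function.Bundles using (mk⇔; _⇔_)
open import Function.Definitions using (Injective)
open import Relation.Binary.Definitions using (tri<; tri≈; tri>)
open import Relation.Nullary using (Dec; yes; no; ¬_; does; proof; contradiction)
open import Relation.Nullary.Decidable using (map′; dec-true)
open import Relation.Nullary.Reflects using (Reflects; invert)
open import Relation.Binary.PropositionalEquality

-- Pigeonhole: an injective endomap of a finite set is surjective.  If i were
-- missed, punching i out of the codomain would inject [m + 1] into [m].
injective⇒surjective : ∀ {m} (f : Fin m → Fin m) → Injective _≡_ _≡_ f →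
                       ∀ i → ∃ λ v → f v ≡ i
injective⇒surjective {suc m} f f-injective i with Fin.any? (λ v → f v ≟ i)
... | yes hit = hit
... | no miss = contradiction (Fin.injective⇒≤ squeezed-injective) (ℕ.n≮n m)
  where
  missed : ∀ v → i ≢ f v
  missed v i≡fv = miss (v , sym i≡fv)

  squeezed : Fin (suc m) → Fin m
  squeezed v = punchOut (missed v)

  squeezed-injective : Injective _≡_ _≡_ squeezed
  squeezed-injective eq = f-injective (Fin.punchOut-injective (missed _) (missed _) eq)

-- Morphisms of 𝓛 also reflect the strict order, as their domains are totally ordered.
reflect< : ∀ {m n} (u : LHom m n) {i j : Fin m} → fun u i < fun u j → i < j
reflect< u {i} {j} ui<uj with Fin.<-cmp i j
... | tri< i<j _ _ = i<j
... | tri≈ _ refl _ = contradiction ui<uj (Fin.<-irrefl refl)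
... | tri> _ _ j<i = contradiction (incr u j<i) (Fin.<-asym ui<uj)

pointL : ∀ {n} → Fin n → LHom 1 n
pointL i = mkL (λ _ → i) (λ { {zero} {zero} () })

pairL : ∀ {n} (i j : Fin n) → i < j → LHom 2 n
pairL {n} i j i<j = mkL pick pick-increasing
  where
  pick : Fin 2 → Fin n
  pick zero       = i
  pick (suc zero) = j

  pick-increasing : ∀ {a b : Fin 2} → a < b → pick a < pick b
  pick-increasing {zero}     {zero}     ()
  pick-increasing {zero}     {suc zero} _ = i<j
  pick-increasing {suc zero} {zero}     ()
  pick-increasing {suc zero} {suc zero} (s≤s ())

lift : ∀ {A : Set} {n} → Dec A → Fin n → Fin (n + n)
lift {n = n} (yes _) i = n ↑ʳ i
lift {n = n} (no _)  i = i ↑ˡ n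

↑ˡ<↑ʳ : ∀ {n} (i j : Fin n) → i ↑ˡ n < n ↑ʳ j
↑ˡ<↑ʳ {n} i j rewrite Fin.toℕ-↑ˡ i n | Fin.toℕ-↑ʳ n j =
  ℕ.<-≤-trans (Fin.toℕ<n i) (ℕ.m≤m+n n (toℕ j))

lift-mono : ∀ {A B : Set} {n} (a? : Dec A) (b? : Dec B) → (A → B) →
            ∀ {i j : Fin n} → i < j → lift a? i < lift b? j
lift-mono {n = n} (yes _) (yes _) _ {i} {j} i<j
  rewrite Fin.toℕ-↑ʳ n i | Fin.toℕ-↑ʳ n j = ℕ.+-monoʳ-< n i<j
lift-mono (yes a) (no ¬b) a→b _ = contradiction (a→b a) ¬b
lift-mono (no _) (yes _) _ {i} {j} _ = ↑ˡ<↑ʳ i j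
lift-mono {n = n} (no _) (no _) _ {i} {j} i<j
  rewrite Fin.toℕ-↑ˡ i n | Fin.toℕ-↑ˡ j n = i<j

lift-below : ∀ {A B : Set} {n} (a? : Dec A) (b? : Dec B) → ¬ A → B →
             (i j : Fin n) → lift a? i < lift b? j
lift-below (yes a) _       ¬a _ _ _ = contradiction a ¬a
lift-below (no _)  (no ¬b) _  b _ _ = contradiction b ¬b
lift-below (no _)  (yes _) _  _ i j = ↑ˡ<↑ʳ i j

module _ {G : FinGraph} where

  _++ₚ_ : ∀ {x y z} → Path G x y → Path G y z → Path G x z
  []           ++ₚ q = q
  step e s p   ++ₚ q = step e s (p ++ₚ q)

  _▷_ : ∀ {x} e → Path G x (src G e) → Path G x (tgt G e)
  e ▷ p = p ++ₚ step e refl []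

record Labelling (G : FinGraph) (n : ℕ) : Set where
  field
    label : Fin (nV G) → Fin n
    edge< : ∀ e → label (src G e) < label (tgt G e)
open Labelling

-- Every cocone restricts to a labelling: naturality along s¹₁ and s¹₀ says
-- that the leg at an edge e sends 0, 1 to the labels of src e, tgt e.
module _ {G : FinGraph} {n : ℕ} (c : Cocone G n) where

  vertexLeg : Fin (nV G) → Fin n
  vertexLeg v = fun (leg c (g1 , v)) zero

  leg-src : ∀ e → fun (leg c (g2 , e)) zero ≡ vertexLeg (src G e)
  leg-src e = nat c (s¹₁ , refl) zero

  leg-tgt : ∀ e → fun (leg c (g2 , e)) (suc zero) ≡ vertexLeg (tgt G e)
  leg-tgt e = nat c (s¹₀ , refl) zero

  labellingOf : Labelling G n
  labellingOf = record
    { label = vertexLeg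
    ; edge< = λ e → subst₂ _<_ (leg-src e) (leg-tgt e) (incr (leg c (g2 , e)) (s≤s z≤n))
    }

coconeOf : ∀ {G n} → Labelling G n → Cocone G n
coconeOf {G} {n} ℓ = record { leg = legAt ; nat = natural }
  where
  legAt : (o : ElObj G) → LHom (I₀ (proj₁ o)) n
  legAt (g1 , v) = pointL (label ℓ v)
  legAt (g2 , e) = pairL _ _ (edge< ℓ e)

  natural : ∀ {o o'} (m : ElHom G o o') → (legAt o' ∘L I₁ (proj₁ m)) ≈L legAt o
  natural {g1 , _} (gid , refl) zero       = refl
  natural {g2 , _} (gid , refl) zero       = refl
  natural {g2 , _} (gid , refl) (suc zero) = refl
  natural (s¹₀ , refl) zero = refl
  natural (s¹₁ , refl) zero = refl

-- A map out of the apex commutes with all legs once it does on the vertex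
-- legs, since the leg at an edge is determined by the legs at its endpoints.
factorsThrough : ∀ {G n n'} (c : Cocone G n) (c' : Cocone G n') (u : LHom n n') →
                 (∀ v → fun u (vertexLeg c v) ≡ vertexLeg c' v) →
                 ∀ o → (u ∘L leg c o) ≈L leg c' o
factorsThrough c c' u onVertices (g1 , v) zero = onVertices v
factorsThrough {G} c c' u onVertices (g2 , e) zero = begin
  fun u (fun (leg c (g2 , e)) zero)  ≡⟨ cong (fun u) (leg-src c e) ⟩
  fun u (vertexLeg c (src G e))      ≡⟨ onVertices (src G e) ⟩
  vertexLeg c' (src G e)             ≡⟨ sym (leg-src c' e) ⟩
  fun (leg c' (g2 , e)) zero         ∎
  where open ≡-Reasoning
factorsThrough {G} c c' u onVertices (g2 , e) (suc zero) = begin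
  fun u (fun (leg c (g2 , e)) (suc zero))  ≡⟨ cong (fun u) (leg-tgt c e) ⟩
  fun u (vertexLeg c (tgt G e))            ≡⟨ onVertices (tgt G e) ⟩
  vertexLeg c' (tgt G e)                   ≡⟨ sym (leg-tgt c' e) ⟩
  fun (leg c' (g2 , e)) (suc zero)         ∎
  where open ≡-Reasoning

module _ {G : FinGraph} {n : ℕ} (ℓ : Labelling G n) where

  path≤ : ∀ {x y} → Path G x y → label ℓ x ≤ label ℓ y
  path≤ []              = ℕ.≤-refl
  path≤ (step e refl p) = ℕ.<⇒≤ (ℕ.<-≤-trans (edge< ℓ e) (path≤ p))

  path< : ∀ {x y} → Path G x y → x ≢ y → label ℓ x < label ℓ y
  path< []              x≢x = contradiction refl x≢x
  path< (step e refl p) _   = ℕ.<-≤-trans (edge< ℓ e) (path≤ p)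

  -- A nonempty cycle would force label x < label x.
  labelled⇒acyclic : Acyclic G
  labelled⇒acyclic x []              = refl
  labelled⇒acyclic x (step e refl p) =
    contradiction (ℕ.<-≤-trans (edge< ℓ e) (path≤ p)) (ℕ.<-irrefl refl)

  -- Reachability is decidable: a path from x stays above label x, so a search
  -- of depth k suffices once n ≤ k + label x.
  path?-within : ∀ k x y → n ≤ℕ k + toℕ (label ℓ x) → Dec (Path G x y)
  path?-within zero    x y n≤ = contradiction n≤ (ℕ.<⇒≱ (Fin.toℕ<n (label ℓ x)))
  path?-within (suc k) x y n≤ with x ≟ y
  ... | yes refl = yes []
  ... | no x≢y   = map′ (λ (e , s , p) → step e s p) firstEdge (Fin.any? startsAt?)
    where
    firstEdge : Path G x y → ∃ λ e → src G e ≡ x × Path G (tgt G e) y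
    firstEdge []           = contradiction refl x≢y
    firstEdge (step e s p) = e , s , p

    startsAt? : ∀ e → Dec (src G e ≡ x × Path G (tgt G e) y)
    startsAt? e with src G e ≟ x
    ... | no s≢x   = no (s≢x ∘ proj₁)
    ... | yes refl = map′ (refl ,_) proj₂ (path?-within k (tgt G e) y deeper)
      where
      deeper : n ≤ℕ k + toℕ (label ℓ (tgt G e))
      deeper = ℕ.≤-trans n≤ (ℕ.≤-trans (ℕ.≤-reflexive (sym (ℕ.+-suc k _)))
                                       (ℕ.+-monoʳ-≤ k (edge< ℓ e)))

  path? : ∀ x y → Dec (Path G x y)
  path? x y = path?-within n x y (ℕ.m≤m+n n _)

module Universal⇒ {G : FinGraph} {n : ℕ} (c : Cocone G n) (universal : IsColimit G n c) where

  ℓ : Labelling G n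
  ℓ = labellingOf c

  raisedFrom : Fin (nV G) → Labelling G (n + n)
  raisedFrom x = record
    { label = λ v → lift (path? ℓ x v) (label ℓ v)
    ; edge< = λ e → lift-mono (path? ℓ x (src G e)) (path? ℓ x (tgt G e)) (e ▷_) (edge< ℓ e)
    }

  -- The factorization u of the raised cocone through c sends label x to the
  -- upper half and label y to the lower half; as u reflects <, y lies below x.
  unreachable⇒below : ∀ {x y} → ¬ Path G x y → label ℓ y < label ℓ x
  unreachable⇒below {x} {y} ¬x⇝y =
    reflect< u (subst₂ _<_ (sym (onVertex y)) (sym (onVertex x))
                 (lift-below (path? ℓ x y) (path? ℓ x x) ¬x⇝y [] (label ℓ y) (label ℓ x)))
    where
    raised : Cocone G (n + n)
    raised = coconeOf (raisedFrom x)

    u : LHom n (n + n)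
    u = proj₁ (universal (n + n) raised)

    onVertex : ∀ v → fun u (label ℓ v) ≡ lift (path? ℓ x v) (label ℓ v)
    onVertex v = proj₁ (proj₂ (universal (n + n) raised)) (g1 , v) zero

  acyclic : Acyclic G
  acyclic = labelled⇒acyclic ℓ

  connected : Connected G
  connected x y with path? ℓ x y | path? ℓ y x
  ... | yes x⇝y | _       = inj₁ x⇝y
  ... | no _    | yes y⇝x = inj₂ y⇝x
  ... | no ¬x⇝y | no ¬y⇝x =
    contradiction (unreachable⇒below ¬x⇝y) (Fin.<-asym (unreachable⇒below ¬y⇝x))

module Rank {N : ℕ} (_≺_ : Fin N → Fin N → Set) (_≺?_ : ∀ x y → Dec (x ≺ y))
            (≺-irrefl : ∀ {x} → ¬ x ≺ x) (≺-trans : ∀ {x y z} → x ≺ y → y ≺ z → x ≺ z) where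

  below : Fin N → Subset N
  below v = tabulate (λ w → does (w ≺? v))

  ∈below : ∀ {w v} → w ≺ v → w ∈ below v
  ∈below {w} {v} w≺v =
    lookup⇒[]= w (below v) (trans (lookup∘tabulate _ w) (dec-true (w ≺? v) w≺v))

  below-≺ : ∀ {w v} → w ∈ below v → w ≺ v
  below-≺ {w} {v} w∈ = invert (subst (Reflects (w ≺ v)) decided (proof (w ≺? v)))
    where
    decided : does (w ≺? v) ≡ true
    decided = trans (sym (lookup∘tabulate _ w)) ([]=⇒lookup w∈)

  rank : Fin N → ℕ
  rank v = ∣ below v ∣

  rank<N : ∀ v → rank v <ℕ N
  rank<N v = subst (rank v <ℕ_) (∣⊤∣≡n N)
    (p⊂q⇒∣p∣<∣q∣ ((λ _ → ∈⊤) , v , ∈⊤ , ≺-irrefl ∘ below-≺))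

  position : Fin N → Fin N
  position v = fromℕ< (rank<N v)

  position-mono : ∀ {x y} → x ≺ y → position x < position y
  position-mono {x} {y} x≺y =
    subst₂ _<ℕ_ (sym (Fin.toℕ-fromℕ< (rank<N x))) (sym (Fin.toℕ-fromℕ< (rank<N y)))
      (p⊂q⇒∣p∣<∣q∣ ((λ w∈ → ∈below (≺-trans (below-≺ w∈) x≺y)) ,
                     x , ∈below x≺y , ≺-irrefl ∘ below-≺))

module Acyclic∧Connected⇒Universal {G : FinGraph} (acyclic : Acyclic G) (connected : Connected G) where

  N : ℕ
  N = nV G

  path-antisym : ∀ {x y} → Path G x y → Path G y x → x ≡ y
  path-antisym []           _ = refl
  path-antisym (step e s p) q with acyclic _ (step e s (p ++ₚ q))
  ... | ()

  _≺_ : Fin N → Fin N → Set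
  x ≺ y = Path G x y × x ≢ y

  _≺?_ : ∀ x y → Dec (x ≺ y)
  x ≺? y with x ≟ y | connected x y
  ... | yes x≡y | _        = no (λ x≺y → proj₂ x≺y x≡y)
  ... | no x≢y  | inj₁ x⇝y = yes (x⇝y , x≢y)
  ... | no x≢y  | inj₂ y⇝x = no (λ x≺y → x≢y (path-antisym (proj₁ x≺y) y⇝x))

  ≺-irrefl : ∀ {x} → ¬ x ≺ x
  ≺-irrefl (_ , x≢x) = x≢x refl

  ≺-trans : ∀ {x y z} → x ≺ y → y ≺ z → x ≺ z
  ≺-trans (x⇝y , _) (y⇝z , y≢z) =
    (x⇝y ++ₚ y⇝z) , λ { refl → y≢z (path-antisym y⇝z x⇝y) }

  ≺-connex : ∀ {x y} → x ≢ y → x ≺ y ⊎ y ≺ x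
  ≺-connex {x} {y} x≢y with connected x y
  ... | inj₁ x⇝y = inj₁ (x⇝y , x≢y)
  ... | inj₂ y⇝x = inj₂ (y⇝x , x≢y ∘ sym)

  open Rank _≺_ _≺?_ ≺-irrefl ≺-trans

  -- Since ≺ is total, position also reflects ≺ and is a bijection.
  position-reflects : ∀ {x y} → position x < position y → x ≺ y
  position-reflects {x} {y} px<py with x ≟ y
  ... | yes refl = contradiction px<py (ℕ.<-irrefl refl)
  ... | no x≢y with ≺-connex x≢y
  ...   | inj₁ x≺y = x≺y
  ...   | inj₂ y≺x = contradiction px<py (Fin.<-asym (position-mono y≺x))

  position-injective : Injective _≡_ _≡_ position
  position-injective {x} {y} px≡py with x ≟ y
  ... | yes x≡y = x≡y
  ... | no x≢y with ≺-connex x≢y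
  ...   | inj₁ x≺y = contradiction px≡py (Fin.<⇒≢ (position-mono x≺y))
  ...   | inj₂ y≺x = contradiction (sym px≡py) (Fin.<⇒≢ (position-mono y≺x))

  vertexAt : Fin N → Fin N
  vertexAt i = proj₁ (injective⇒surjective position position-injective i)

  position-vertexAt : ∀ i → position (vertexAt i) ≡ i
  position-vertexAt i = proj₂ (injective⇒surjective position position-injective i)

  vertexAt-position : ∀ v → vertexAt (position v) ≡ v
  vertexAt-position v = position-injective (position-vertexAt (position v))

  -- A loop would be a nonempty cycle, so positions increase along edges.
  no-loop : ∀ e → src G e ≢ tgt G e
  no-loop e src≡tgt with acyclic (tgt G e) (step e src≡tgt [])
  ... | ()

  positions : Labelling G N
  positions = record
    { label = position
    ; edge< = λ e → position-mono (step e refl [] , no-loop e)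
    }

  -- The factorization of a cocone c' sends position v to the leg of c' at v;
  -- it is increasing because the labels of c' increase along ≺.
  universal : IsColimit G N (coconeOf positions)
  universal n' c' = u , factors , unique
    where
    u : LHom N n'
    u = mkL (vertexLeg c' ∘ vertexAt) λ {i} {j} i<j →
      let (i⇝j , i≢j) = position-reflects (subst₂ _<_ (sym (position-vertexAt i))
                                                      (sym (position-vertexAt j)) i<j)
      in path< (labellingOf c') i⇝j i≢j

    factors : ∀ o → (u ∘L leg (coconeOf positions) o) ≈L leg c' o
    factors = factorsThrough (coconeOf positions) c' u (cong (vertexLeg c') ∘ vertexAt-position)

    unique : ∀ u' → (∀ o → (u' ∘L leg (coconeOf positions) o) ≈L leg c' o) → u' ≈L u
    unique u' u'-factors i = begin
      fun u' i                          ≡⟨ cong (fun u') (sym (position-vertexAt i)) ⟩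
      fun u' (position (vertexAt i))    ≡⟨ u'-factors (g1 , vertexAt i) zero ⟩
      vertexLeg c' (vertexAt i)         ∎
      where open ≡-Reasoning

lemma13 : (G : FinGraph) → HasColimit G ⇔ (Acyclic G × Connected G)
lemma13 G = mk⇔
  (λ (n , c , isColimit) → let open Universal⇒ c isColimit in acyclic , connected)
  (λ (acyclic , connected) → let open Acyclic∧Connected⇒Universal acyclic connected
                             in N , coconeOf positions , universal)
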